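{- For non-negative integers $n$ and $m$, \[ \sum_{k=0}^n (-1)^{mk} \binom {n+k}{k} \frac{F_{m(n+1-k)}}{L_m^k} = F_m L_m^{n} \Bigg ( 1 + 2\sum_{k=0}^{n-1} \frac{(-1)^{m(k+1)}}{L_m^{2(k+1)}} \binom {2k+1}{k} \Bigg ) \] and \[ \sum_{k=0}^n (-1)^{mk} \binom {n+k}{k} \frac{L_{m(n+1-k)}}{L_m^k} = L_m^{n+1}. \]
   Context: $F_j$ and $L_j$ denote the Fibonacci and Lucas numbers: $F_0=0,F_1=1$, $L_0=2,L_1=1$, both satisfying $X_j=X_{j-1}+X_{j-2}$. -}

module Defs where

open import Data.Nat as ℕ using (ℕ; zero; suc; _+_; _*_; _∸_; _^_; NonZero)
open import Data.Nat.Properties using (m^n≢0)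
open import Data.Integer using (ℤ; +_)
open import Data.Rational using (ℚ; _/_; 0ℚ; 1ℚ; -_)
import Data.Rational as Q

fib : ℕ → ℕ
fib 0 = 0
fib 1 = 1
fib (suc (suc n)) = fib (suc n) + fib n

luc : ℕ → ℕ
luc 0 = 2
luc 1 = 1
luc (suc (suc n)) = luc (suc n) + luc n

luc-pos : ∀ j → 1 ℕ.≤ luc j
luc-pos 0 = ℕ.s≤s ℕ.z≤n
luc-pos 1 = ℕ.s≤s ℕ.z≤n
luc-pos (suc (suc j)) = Data.Nat.Properties.≤-trans (luc-pos (suc j)) (Data.Nat.Properties.m≤m+n (luc (suc j)) (luc j))
  where import Data.Nat.Properties

_/L[_]^_ : ℕ → ℕ → ℕ → ℚ
a /L[ m ]^ k = _/_ (+ a) (luc m ^ k) {{m^n≢0 (luc m) k {{ℕ.>-nonZero (luc-pos m)}}}}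

_^ℚ_ : ℚ → ℕ → ℚ
x ^ℚ zero = 1ℚ
x ^ℚ suc k = x Q.* (x ^ℚ k)

sgn : ℕ → ℚ
sgn e = (- 1ℚ) ^ℚ e

ℕ→ℚ : ℕ → ℚ
ℕ→ℚ a = (+ a) / 1

sumTo : ℕ → (ℕ → ℚ) → ℚ
sumTo zero f = f 0
sumTo (suc n) f = sumTo n f Q.+ f (suc n)

sumBelow : ℕ → (ℕ → ℚ) → ℚ
sumBelow zero f = 0ℚ
sumBelow (suc n) f = sumBelow n f Q.+ f n

-- Put i = 1/L_m, e = (-1)^m i² and r_j = X_{mj} i^j for X = F or L. Then both left-hand sides are
-- L_m^{n+1} T_n(r) with T_n(r) = Σ_{k≤n} C(n+k,k) e^k r_{n+1-k}, and L_m X_{j+m} = X_{j+2m} + (-1)^m X_j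
-- turns into the recurrence r_{j+2} = r_{j+1} - e r_j. For any such r, Pascal's rule applied to
-- T_{n+1} of the double shift of r gives T_{n+1}(r) - T_n(r) = C(2n+1,n) e^{n+1} (2 r_1 - r_0), so
-- T_n(r) = r_1 + (2 r_1 - r_0) Σ_{k<n} e^{k+1} C(2k+1,k). For Lucas r_0 = 2 and r_1 = 1, which kills
-- the sum; for Fibonacci r_0 = 0 and r_1 = F_m / L_m.

module Submission where

open import Defs
open import Data.Nat as ℕ using (ℕ; zero; suc; _+_; _*_; _∸_; _^_; NonZero)
import Data.Nat.Properties as NP
open import Data.Nat.Combinatorics using (_C_; nCk+nC[k+1]≡[n+1]C[k+1]; nCk≡nC[n∸k])
open import Data.Integer as ℤ using (ℤ; +_)
import Data.Integer.Properties as ZP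
open import Data.Rational as Q using (ℚ; _/_; 0ℚ; 1ℚ; -_; _-_) renaming (_+_ to _+ℚ_; _*_ to _*ℚ_)
import Data.Rational.Properties as QP
import Data.Rational.Unnormalised as U
import Data.Rational.Unnormalised.Properties as UP
open import Data.Rational.Solver using (module +-*-Solver)
open import Data.Product using (_×_; _,_)
open import Function using (_∘_)
open import Relation.Binary.PropositionalEquality
open ≡-Reasoning
open +-*-Solver

toℚᵘ-/ : ∀ (i : ℤ) k → Q.toℚᵘ (i / suc k) U.≃ U.mkℚᵘ i k
toℚᵘ-/ i k = QP.toℚᵘ-fromℚᵘ (U.mkℚᵘ i k)

ℕ→ℚ-+ : ∀ a b → ℕ→ℚ (a + b) ≡ ℕ→ℚ a +ℚ ℕ→ℚ b
ℕ→ℚ-+ a b = QP.toℚᵘ-injective (UP.≃-trans (toℚᵘ-/ (+ (a + b)) 0) (UP.≃-trans (U.*≡* eq)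
  (UP.≃-sym (UP.≃-trans (QP.toℚᵘ-homo-+ (ℕ→ℚ a) (ℕ→ℚ b)) (UP.+-cong (toℚᵘ-/ (+ a) 0) (toℚᵘ-/ (+ b) 0))))))
  where
  eq : + (a + b) ℤ.* + 1 ≡ (+ a ℤ.* + 1 ℤ.+ + b ℤ.* + 1) ℤ.* + 1
  eq = cong (ℤ._* + 1) (trans (ZP.pos-+ a b) (sym (cong₂ ℤ._+_ (ZP.*-identityʳ (+ a)) (ZP.*-identityʳ (+ b)))))

ℕ→ℚ-* : ∀ a b → ℕ→ℚ (a * b) ≡ ℕ→ℚ a *ℚ ℕ→ℚ b
ℕ→ℚ-* a b = QP.toℚᵘ-injective (UP.≃-trans (toℚᵘ-/ (+ (a * b)) 0) (UP.≃-trans (U.*≡* eq)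
  (UP.≃-sym (UP.≃-trans (QP.toℚᵘ-homo-* (ℕ→ℚ a) (ℕ→ℚ b)) (UP.*-cong (toℚᵘ-/ (+ a) 0) (toℚᵘ-/ (+ b) 0))))))
  where
  eq : + (a * b) ℤ.* + 1 ≡ (+ a ℤ.* + b) ℤ.* + 1
  eq = cong (ℤ._* + 1) (ZP.pos-* a b)

+m/n*n≡m : ∀ a d .{{_ : NonZero d}} → (+ a) / d *ℚ ℕ→ℚ d ≡ ℕ→ℚ a
+m/n*n≡m a (suc k) = QP.toℚᵘ-injective (UP.≃-trans (QP.toℚᵘ-homo-* ((+ a) / suc k) (ℕ→ℚ (suc k)))
  (UP.≃-trans (UP.*-cong (toℚᵘ-/ (+ a) k) (toℚᵘ-/ (+ suc k) 0)) (UP.≃-trans (U.*≡* eq) (UP.≃-sym (toℚᵘ-/ (+ a) 0)))))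
  where
  eq : (+ a ℤ.* + suc k) ℤ.* + 1 ≡ + a ℤ.* + (suc k ℕ.* 1)
  eq = trans (ZP.*-identityʳ _) (cong (+ a ℤ.*_) (cong +_ (sym (NP.*-identityʳ (suc k)))))

^ℚ-distribˡ-+-* : ∀ x a b → x ^ℚ (a + b) ≡ x ^ℚ a *ℚ x ^ℚ b
^ℚ-distribˡ-+-* x zero b = sym (QP.*-identityˡ (x ^ℚ b))
^ℚ-distribˡ-+-* x (suc a) b = trans (cong (x *ℚ_) (^ℚ-distribˡ-+-* x a b)) (sym (QP.*-assoc x (x ^ℚ a) (x ^ℚ b)))

^ℚ-distribʳ-* : ∀ x y k → (x *ℚ y) ^ℚ k ≡ x ^ℚ k *ℚ y ^ℚ k
^ℚ-distribʳ-* x y zero = sym (QP.*-identityˡ 1ℚ)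
^ℚ-distribʳ-* x y (suc k) = trans (cong ((x *ℚ y) *ℚ_) (^ℚ-distribʳ-* x y k))
  (solve 4 (λ x y a b → (x :* y) :* (a :* b) := (x :* a) :* (y :* b)) refl x y (x ^ℚ k) (y ^ℚ k))

^ℚ-zeroˡ : ∀ k → 1ℚ ^ℚ k ≡ 1ℚ
^ℚ-zeroˡ zero = refl
^ℚ-zeroˡ (suc k) = trans (QP.*-identityˡ (1ℚ ^ℚ k)) (^ℚ-zeroˡ k)

ℕ→ℚ-^ : ∀ a k → ℕ→ℚ (a ^ k) ≡ ℕ→ℚ a ^ℚ k
ℕ→ℚ-^ a zero = refl
ℕ→ℚ-^ a (suc k) = trans (ℕ→ℚ-* a (a ^ k)) (cong (ℕ→ℚ a *ℚ_) (ℕ→ℚ-^ a k))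

sgn-* : ∀ m k → sgn (m * k) ≡ sgn m ^ℚ k
sgn-* m zero = cong sgn (NP.*-zeroʳ m)
sgn-* m (suc k) = trans (cong sgn (NP.*-suc m k)) (trans (^ℚ-distribˡ-+-* (- 1ℚ) m (m * k)) (cong (sgn m *ℚ_) (sgn-* m k)))

sgn*sgn≡1 : ∀ m → sgn m *ℚ sgn m ≡ 1ℚ
sgn*sgn≡1 zero = QP.*-identityˡ 1ℚ
sgn*sgn≡1 (suc m) = trans (solve 1 (λ s → (:- con 1ℚ :* s) :* (:- con 1ℚ :* s) := s :* s) refl (sgn m)) (sgn*sgn≡1 m)

sumTo-cong : ∀ n {f g : ℕ → ℚ} → (∀ k → k ℕ.≤ n → f k ≡ g k) → sumTo n f ≡ sumTo n g
sumTo-cong zero f≗g = f≗g 0 ℕ.z≤n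
sumTo-cong (suc n) f≗g = cong₂ _+ℚ_ (sumTo-cong n (λ k k≤n → f≗g k (NP.m≤n⇒m≤1+n k≤n))) (f≗g (suc n) NP.≤-refl)

sumTo-suc : ∀ n f → sumTo (suc n) f ≡ f 0 +ℚ sumTo n (f ∘ suc)
sumTo-suc zero f = refl
sumTo-suc (suc n) f = trans (cong (_+ℚ f (suc (suc n))) (sumTo-suc n f)) (QP.+-assoc (f 0) (sumTo n (f ∘ suc)) (f (suc (suc n))))

sumTo-linear : ∀ n f g c → sumTo n (λ k → f k +ℚ c *ℚ g k) ≡ sumTo n f +ℚ c *ℚ sumTo n g
sumTo-linear zero f g c = refl
sumTo-linear (suc n) f g c = trans (cong (_+ℚ (f (suc n) +ℚ c *ℚ g (suc n))) (sumTo-linear n f g c))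
  (solve 5 (λ a b c d e → (a :+ c :* b) :+ (d :+ c :* e) := (a :+ d) :+ c :* (b :+ e)) refl (sumTo n f) (sumTo n g) c (f (suc n)) (g (suc n)))

sumTo-distribˡ : ∀ n f c → sumTo n (λ k → c *ℚ f k) ≡ c *ℚ sumTo n f
sumTo-distribˡ zero f c = refl
sumTo-distribˡ (suc n) f c = trans (cong (_+ℚ c *ℚ f (suc n)) (sumTo-distribˡ n f c)) (sym (QP.*-distribˡ-+ c (sumTo n f) (f (suc n))))

sumBelow-cong : ∀ n {f g : ℕ → ℚ} → (∀ k → f k ≡ g k) → sumBelow n f ≡ sumBelow n g
sumBelow-cong zero f≗g = refl
sumBelow-cong (suc n) f≗g = cong₂ _+ℚ_ (sumBelow-cong n f≗g) (f≗g n)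

[2n+1]C[n+1]≡[2n+1]C[n] : ∀ n → (n + suc n) C suc n ≡ (n + suc n) C n
[2n+1]C[n+1]≡[2n+1]C[n] n = trans (nCk≡nC[n∸k] (NP.m≤n+m (suc n) n)) (cong ((n + suc n) C_) (NP.m+n∸n≡m n (suc n)))

[2n+2]C[n+1]≡2[2n+1]C[n] : ∀ n → (suc n + suc n) C suc n ≡ (n + suc n) C n + (n + suc n) C n
[2n+2]C[n+1]≡2[2n+1]C[n] n =
  trans (sym (nCk+nC[k+1]≡[n+1]C[k+1] (n + suc n) n)) (cong (_+_ ((n + suc n) C n)) ([2n+1]C[n+1]≡[2n+1]C[n] n))

module BinomialConvolution (e : ℚ) where

  term : ℕ → (ℕ → ℚ) → ℕ → ℚ
  term n r k = ℕ→ℚ ((n + k) C k) *ℚ (e ^ℚ k *ℚ r (suc n ∸ k))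

  binomSum : ℕ → (ℕ → ℚ) → ℚ
  binomSum n r = sumTo n (term n r)

  binomSum-linear : ∀ n {p q w} c → (∀ j → p j ≡ q j +ℚ c *ℚ w j) → binomSum n p ≡ binomSum n q +ℚ c *ℚ binomSum n w
  binomSum-linear n {p} {q} {w} c p≗q+cw = trans (sumTo-cong n termwise) (sumTo-linear n (term n q) (term n w) c)
    where
    termwise : ∀ k → k ℕ.≤ n → term n p k ≡ term n q k +ℚ c *ℚ term n w k
    termwise k _ = trans (cong (λ z → ℕ→ℚ ((n + k) C k) *ℚ (e ^ℚ k *ℚ z)) (p≗q+cw (suc n ∸ k)))
      (solve 5 (λ a b x y c → a :* (b :* (x :+ c :* y)) := a :* (b :* x) :+ c :* (a :* (b :* y))) refl
        (ℕ→ℚ ((n + k) C k)) (e ^ℚ k) (q (suc n ∸ k)) (w (suc n ∸ k)) c)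

  binomSum-pascal : ∀ n r →
    binomSum (suc n) (r ∘ suc) ≡ binomSum n (r ∘ suc ∘ suc) +ℚ e *ℚ binomSum (suc n) r
      +ℚ e ^ℚ suc n *ℚ (ℕ→ℚ ((n + suc n) C suc n) *ℚ r 2 - e *ℚ (ℕ→ℚ ((suc n + suc n) C suc n) *ℚ r 1))
  binomSum-pascal n r = begin
    binomSum (suc n) (r ∘ suc)
      ≡⟨ sumTo-suc n (term (suc n) (r ∘ suc)) ⟩
    term n r'' 0 +ℚ sumTo n (term (suc n) (r ∘ suc) ∘ suc)
      ≡⟨ cong (term n r'' 0 +ℚ_) (trans (sumTo-cong n pascal) (sumTo-linear n (term n r'' ∘ suc) (term (suc n) r) e)) ⟩
    term n r'' 0 +ℚ (sumTo n (term n r'' ∘ suc) +ℚ e *ℚ sumTo n (term (suc n) r))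
      ≡⟨ trans (sym (QP.+-assoc (term n r'' 0) _ _)) (cong (_+ℚ e *ℚ sumTo n (term (suc n) r)) (sym (sumTo-suc n (term n r'')))) ⟩
    sumTo (suc n) (term n r'') +ℚ e *ℚ sumTo n (term (suc n) r)
      ≡⟨ solve 8 (λ X c₁ E A e S c₂ B → X :+ c₁ :* (E :* A) :+ e :* S := X :+ e :* (S :+ c₂ :* (E :* B)) :+ E :* (c₁ :* A :- e :* (c₂ :* B))) refl
           (binomSum n r'') c₁ E (r (2 + (n ∸ n))) e (sumTo n (term (suc n) r)) c₂ (r (suc n ∸ n)) ⟩
    binomSum n r'' +ℚ e *ℚ binomSum (suc n) r +ℚ E *ℚ (c₁ *ℚ r (2 + (n ∸ n)) - e *ℚ (c₂ *ℚ r (suc n ∸ n)))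
      ≡⟨ cong₂ (λ i j → binomSum n r'' +ℚ e *ℚ binomSum (suc n) r +ℚ E *ℚ (c₁ *ℚ r (2 + i) - e *ℚ (c₂ *ℚ r j))) (NP.n∸n≡0 n) (NP.m+n∸n≡m 1 n) ⟩
    binomSum n r'' +ℚ e *ℚ binomSum (suc n) r +ℚ E *ℚ (c₁ *ℚ r 2 - e *ℚ (c₂ *ℚ r 1)) ∎
    where
    r'' = r ∘ suc ∘ suc
    E = e ^ℚ suc n
    c₁ = ℕ→ℚ ((n + suc n) C suc n)
    c₂ = ℕ→ℚ ((suc n + suc n) C suc n)
    pascal : ∀ k → k ℕ.≤ n → term (suc n) (r ∘ suc) (suc k) ≡ term n r'' (suc k) +ℚ e *ℚ term (suc n) r k
    pascal k k≤n = begin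
      term (suc n) (r ∘ suc) (suc k)
        ≡⟨ cong₂ (λ c j → ℕ→ℚ c *ℚ (e ^ℚ suc k *ℚ r (suc j))) (sym (nCk+nC[k+1]≡[n+1]C[k+1] (n + suc k) k)) (NP.+-∸-assoc 1 k≤n) ⟩
      ℕ→ℚ (a + b) *ℚ (e *ℚ e ^ℚ k *ℚ x)
        ≡⟨ cong (_*ℚ (e *ℚ e ^ℚ k *ℚ x)) (ℕ→ℚ-+ a b) ⟩
      (ℕ→ℚ a +ℚ ℕ→ℚ b) *ℚ (e *ℚ e ^ℚ k *ℚ x)
        ≡⟨ solve 5 (λ a b e E x → (a :+ b) :* (e :* E :* x) := b :* (e :* E :* x) :+ e :* (a :* (E :* x))) refl (ℕ→ℚ a) (ℕ→ℚ b) e (e ^ℚ k) x ⟩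
      term n r'' (suc k) +ℚ e *ℚ (ℕ→ℚ a *ℚ (e ^ℚ k *ℚ x))
        ≡⟨ cong₂ (λ c j → term n r'' (suc k) +ℚ e *ℚ (ℕ→ℚ (c C k) *ℚ (e ^ℚ k *ℚ r j))) (NP.+-suc n k) (sym (NP.+-∸-assoc 2 k≤n)) ⟩
      term n r'' (suc k) +ℚ e *ℚ term (suc n) r k ∎
      where
      a = (n + suc k) C k
      b = (n + suc k) C suc k
      x = r (2 + (n ∸ k))

  Recurrent : (ℕ → ℚ) → Set
  Recurrent r = ∀ j → r (suc (suc j)) ≡ r (suc j) +ℚ - e *ℚ r j

  binomSum-suc-shift₂ : ∀ n r → Recurrent r →
    binomSum (suc n) (r ∘ suc ∘ suc) ≡ binomSum n (r ∘ suc ∘ suc)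
      +ℚ e ^ℚ suc n *ℚ (ℕ→ℚ ((n + suc n) C suc n) *ℚ r 2 - e *ℚ (ℕ→ℚ ((suc n + suc n) C suc n) *ℚ r 1))
  binomSum-suc-shift₂ n r rec = begin
    binomSum (suc n) (r ∘ suc ∘ suc)            ≡⟨ binomSum-linear (suc n) {q = r ∘ suc} {w = r} (- e) rec ⟩
    binomSum (suc n) (r ∘ suc) +ℚ - e *ℚ A      ≡⟨ cong (_+ℚ - e *ℚ A) (binomSum-pascal n r) ⟩
    binomSum n (r ∘ suc ∘ suc) +ℚ e *ℚ A +ℚ K +ℚ - e *ℚ A
      ≡⟨ solve 4 (λ B e A K → B :+ e :* A :+ K :+ :- e :* A := B :+ K) refl (binomSum n (r ∘ suc ∘ suc)) e A K ⟩
    binomSum n (r ∘ suc ∘ suc) +ℚ K ∎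
    where
    A = binomSum (suc n) r
    K = e ^ℚ suc n *ℚ (ℕ→ℚ ((n + suc n) C suc n) *ℚ r 2 - e *ℚ (ℕ→ℚ ((suc n + suc n) C suc n) *ℚ r 1))

  centralSum : ℕ → ℚ
  centralSum n = sumBelow n (λ k → e ^ℚ suc k *ℚ ℕ→ℚ ((k + suc k) C k))

  module _ (u : ℚ) (e*u≡1 : e *ℚ u ≡ 1ℚ) where

    back : ℚ → ℚ → ℚ
    back a b = u *ℚ (a - b)

    e*back≡- : ∀ a b → e *ℚ back a b ≡ a - b
    e*back≡- a b = begin
      e *ℚ (u *ℚ (a - b))  ≡⟨ sym (QP.*-assoc e u (a - b)) ⟩
      e *ℚ u *ℚ (a - b)    ≡⟨ cong (_*ℚ (a - b)) e*u≡1 ⟩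
      1ℚ *ℚ (a - b)        ≡⟨ QP.*-identityˡ (a - b) ⟩
      a - b                ∎

    back-recurrent : ∀ a b → b ≡ a +ℚ - e *ℚ back a b
    back-recurrent a b = begin
      b                       ≡⟨ solve 2 (λ a b → b := a :- (a :- b)) refl a b ⟩
      a - (a - b)             ≡⟨ cong (_-_ a) (sym (e*back≡- a b)) ⟩
      a - e *ℚ back a b       ≡⟨ cong (a +ℚ_) (QP.neg-distribˡ-* e (back a b)) ⟩
      a +ℚ - e *ℚ back a b    ∎

    -- Running the recurrence backwards makes r the double shift of a recurrent sequence,
    -- to which binomSum-suc-shift₂ applies.
    extend : (ℕ → ℚ) → ℕ → ℚ
    extend r 0 = back (back (r 0) (r 1)) (r 0)
    extend r 1 = back (r 0) (r 1)
    extend r (suc (suc j)) = r j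

    extend-recurrent : ∀ r → Recurrent r → Recurrent (extend r)
    extend-recurrent r rec 0 = back-recurrent (back (r 0) (r 1)) (r 0)
    extend-recurrent r rec 1 = back-recurrent (r 0) (r 1)
    extend-recurrent r rec (suc (suc j)) = rec j

    binomSum-suc : ∀ n r → Recurrent r →
      binomSum (suc n) r ≡ binomSum n r +ℚ ℕ→ℚ ((n + suc n) C n) *ℚ (e ^ℚ suc n *ℚ (r 1 +ℚ r 1 - r 0))
    binomSum-suc n r rec = begin
      binomSum (suc n) r
        ≡⟨ binomSum-suc-shift₂ n (extend r) (extend-recurrent r rec) ⟩
      binomSum n r +ℚ E *ℚ (ℕ→ℚ ((n + suc n) C suc n) *ℚ r 0 - e *ℚ (ℕ→ℚ ((suc n + suc n) C suc n) *ℚ back (r 0) (r 1)))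
        ≡⟨ cong₂ (λ a b → binomSum n r +ℚ E *ℚ (a *ℚ r 0 - e *ℚ (b *ℚ back (r 0) (r 1))))
             (cong ℕ→ℚ ([2n+1]C[n+1]≡[2n+1]C[n] n))
             (trans (cong ℕ→ℚ ([2n+2]C[n+1]≡2[2n+1]C[n] n)) (ℕ→ℚ-+ ((n + suc n) C n) ((n + suc n) C n))) ⟩
      binomSum n r +ℚ E *ℚ (c *ℚ r 0 - e *ℚ ((c +ℚ c) *ℚ back (r 0) (r 1)))
        ≡⟨ cong (λ z → binomSum n r +ℚ E *ℚ (c *ℚ r 0 - z))
             (trans (solve 3 (λ e c b → e :* ((c :+ c) :* b) := (c :+ c) :* (e :* b)) refl e c (back (r 0) (r 1)))
                    (cong ((c +ℚ c) *ℚ_) (e*back≡- (r 0) (r 1)))) ⟩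
      binomSum n r +ℚ E *ℚ (c *ℚ r 0 - (c +ℚ c) *ℚ (r 0 - r 1))
        ≡⟨ solve 5 (λ S E c a b → S :+ E :* (c :* a :- (c :+ c) :* (a :- b)) := S :+ c :* (E :* (b :+ b :- a))) refl (binomSum n r) E c (r 0) (r 1) ⟩
      binomSum n r +ℚ c *ℚ (E *ℚ (r 1 +ℚ r 1 - r 0)) ∎
      where
      E = e ^ℚ suc n
      c = ℕ→ℚ ((n + suc n) C n)

    binomSum-closed : ∀ n r → Recurrent r → binomSum n r ≡ r 1 +ℚ (r 1 +ℚ r 1 - r 0) *ℚ centralSum n
    binomSum-closed zero r rec = solve 2 (λ a w → con 1ℚ :* (con 1ℚ :* a) := a :+ w :* con 0ℚ) refl (r 1) (r 1 +ℚ r 1 - r 0)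
    binomSum-closed (suc n) r rec = begin
      binomSum (suc n) r                ≡⟨ binomSum-suc n r rec ⟩
      binomSum n r +ℚ c *ℚ (E *ℚ W)     ≡⟨ cong (_+ℚ c *ℚ (E *ℚ W)) (binomSum-closed n r rec) ⟩
      r 1 +ℚ W *ℚ centralSum n +ℚ c *ℚ (E *ℚ W)
        ≡⟨ solve 5 (λ a w s c x → a :+ w :* s :+ c :* (x :* w) := a :+ w :* (s :+ x :* c)) refl (r 1) W (centralSum n) c E ⟩
      r 1 +ℚ W *ℚ centralSum (suc n)   ∎
      where
      c = ℕ→ℚ ((n + suc n) C n)
      E = e ^ℚ suc n
      W = r 1 +ℚ r 1 - r 0

FibonacciLike : (ℕ → ℚ) → Set
FibonacciLike x = ∀ j → x (suc (suc j)) ≡ x (suc j) +ℚ x j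

luc-shift : ∀ m x → FibonacciLike x → ∀ j → ℕ→ℚ (luc m) *ℚ x (m + j) ≡ x (m + (m + j)) +ℚ sgn m *ℚ x j
luc-shift zero x x-rec j = solve 1 (λ y → (con 1ℚ :+ con 1ℚ) :* y := y :+ con 1ℚ :* y) refl (x j)
luc-shift (suc zero) x x-rec j = begin
  1ℚ *ℚ x (suc j)                         ≡⟨ solve 2 (λ a b → con 1ℚ :* a := (a :+ b) :+ (:- con 1ℚ :* con 1ℚ) :* b) refl (x (suc j)) (x j) ⟩
  x (suc j) +ℚ x j +ℚ sgn 1 *ℚ x j        ≡⟨ cong (_+ℚ sgn 1 *ℚ x j) (sym (x-rec j)) ⟩
  x (suc (suc j)) +ℚ sgn 1 *ℚ x j         ∎
luc-shift (suc (suc m)) x x-rec j = begin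
  ℕ→ℚ (luc (suc m) + luc m) *ℚ x (2 + (m + j))
    ≡⟨ cong (_*ℚ x (2 + (m + j))) (ℕ→ℚ-+ (luc (suc m)) (luc m)) ⟩
  (ℕ→ℚ (luc (suc m)) +ℚ ℕ→ℚ (luc m)) *ℚ x (2 + (m + j))
    ≡⟨ QP.*-distribʳ-+ (x (2 + (m + j))) (ℕ→ℚ (luc (suc m))) (ℕ→ℚ (luc m)) ⟩
  ℕ→ℚ (luc (suc m)) *ℚ x (2 + (m + j)) +ℚ ℕ→ℚ (luc m) *ℚ x (2 + (m + j))
    ≡⟨ cong₂ _+ℚ_ (luc-shift (suc m) (x ∘ suc) (x-rec ∘ suc) j) (luc-shift m (x ∘ suc ∘ suc) (x-rec ∘ suc ∘ suc) j) ⟩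
  x (2 + (m + suc (m + j))) +ℚ sgn (suc m) *ℚ x (suc j) +ℚ (x (2 + N) +ℚ sgn m *ℚ x (2 + j))
    ≡⟨ cong₂ (λ i y → x (2 + i) +ℚ sgn (suc m) *ℚ x (suc j) +ℚ (x (2 + N) +ℚ sgn m *ℚ y)) (NP.+-suc m (m + j)) (x-rec j) ⟩
  x (3 + N) +ℚ - 1ℚ *ℚ sgn m *ℚ x (suc j) +ℚ (x (2 + N) +ℚ sgn m *ℚ (x (suc j) +ℚ x j))
    ≡⟨ solve 5 (λ a b c d s → a :+ :- con 1ℚ :* s :* c :+ (b :+ s :* (c :+ d)) := (a :+ b) :+ (:- con 1ℚ :* (:- con 1ℚ :* s)) :* d) refl
         (x (3 + N)) (x (2 + N)) (x (suc j)) (x j) (sgn m) ⟩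
  x (3 + N) +ℚ x (2 + N) +ℚ sgn (2 + m) *ℚ x j
    ≡⟨ cong (_+ℚ sgn (2 + m) *ℚ x j) (sym (x-rec (2 + N))) ⟩
  x (4 + N) +ℚ sgn (2 + m) *ℚ x j
    ≡⟨ cong (λ i → x (2 + i) +ℚ sgn (2 + m) *ℚ x j) (sym (trans (NP.+-suc m (suc (m + j))) (cong suc (NP.+-suc m (m + j))))) ⟩
  x (2 + (m + (2 + (m + j)))) +ℚ sgn (2 + m) *ℚ x j ∎
  where
  N = m + (m + j)

module Scaling (m : ℕ) where

  private
    instance
      luc≢0 : NonZero (luc m)
      luc≢0 = ℕ.>-nonZero (luc-pos m)

  i : ℚ
  i = 1 /L[ m ]^ 1

  e : ℚ
  e = sgn m *ℚ (i *ℚ i)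

  open BinomialConvolution e

  luc*i≡1 : ℕ→ℚ (luc m) *ℚ i ≡ 1ℚ
  luc*i≡1 = trans (cong (λ z → ℕ→ℚ z *ℚ i) (sym (NP.*-identityʳ (luc m))))
                  (trans (QP.*-comm (ℕ→ℚ (luc m ^ 1)) i) (+m/n*n≡m 1 (luc m ^ 1) {{NP.m^n≢0 (luc m) 1}}))

  luc^k*i^k≡1 : ∀ k → ℕ→ℚ (luc m ^ k) *ℚ i ^ℚ k ≡ 1ℚ
  luc^k*i^k≡1 k = begin
    ℕ→ℚ (luc m ^ k) *ℚ i ^ℚ k        ≡⟨ cong (_*ℚ i ^ℚ k) (ℕ→ℚ-^ (luc m) k) ⟩
    ℕ→ℚ (luc m) ^ℚ k *ℚ i ^ℚ k       ≡⟨ sym (^ℚ-distribʳ-* (ℕ→ℚ (luc m)) i k) ⟩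
    (ℕ→ℚ (luc m) *ℚ i) ^ℚ k          ≡⟨ cong (_^ℚ k) luc*i≡1 ⟩
    1ℚ ^ℚ k                          ≡⟨ ^ℚ-zeroˡ k ⟩
    1ℚ                               ∎

  /L^≡*i^ : ∀ a k → a /L[ m ]^ k ≡ ℕ→ℚ a *ℚ i ^ℚ k
  /L^≡*i^ a k = begin
    a /L[ m ]^ k                                     ≡⟨ sym (QP.*-identityʳ (a /L[ m ]^ k)) ⟩
    a /L[ m ]^ k *ℚ 1ℚ                               ≡⟨ cong (a /L[ m ]^ k *ℚ_) (sym (luc^k*i^k≡1 k)) ⟩
    a /L[ m ]^ k *ℚ (ℕ→ℚ (luc m ^ k) *ℚ i ^ℚ k)      ≡⟨ sym (QP.*-assoc (a /L[ m ]^ k) (ℕ→ℚ (luc m ^ k)) (i ^ℚ k)) ⟩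
    a /L[ m ]^ k *ℚ ℕ→ℚ (luc m ^ k) *ℚ i ^ℚ k        ≡⟨ cong (_*ℚ i ^ℚ k) (+m/n*n≡m a (luc m ^ k) {{NP.m^n≢0 (luc m) k}}) ⟩
    ℕ→ℚ a *ℚ i ^ℚ k                                  ∎

  e⁻¹ : ℚ
  e⁻¹ = sgn m *ℚ (ℕ→ℚ (luc m) *ℚ ℕ→ℚ (luc m))

  e*e⁻¹≡1 : e *ℚ e⁻¹ ≡ 1ℚ
  e*e⁻¹≡1 = begin
    e *ℚ (s *ℚ (L *ℚ L))             ≡⟨ solve 3 (λ s i L → (s :* (i :* i)) :* (s :* (L :* L)) := (s :* s) :* ((L :* i) :* (L :* i))) refl s i L ⟩
    (s *ℚ s) *ℚ ((L *ℚ i) *ℚ (L *ℚ i)) ≡⟨ cong₂ (λ a b → a *ℚ (b *ℚ b)) (sgn*sgn≡1 m) luc*i≡1 ⟩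
    1ℚ *ℚ (1ℚ *ℚ 1ℚ)                 ≡⟨ refl ⟩
    1ℚ                               ∎
    where
    s = sgn m
    L = ℕ→ℚ (luc m)

  e^k≡sgn^k*i^k*i^k : ∀ k → e ^ℚ k ≡ sgn m ^ℚ k *ℚ (i ^ℚ k *ℚ i ^ℚ k)
  e^k≡sgn^k*i^k*i^k k = trans (^ℚ-distribʳ-* (sgn m) (i *ℚ i) k) (cong (sgn m ^ℚ k *ℚ_) (^ℚ-distribʳ-* i i k))

  scaled : (ℕ → ℚ) → ℕ → ℚ
  scaled x j = x (m * j) *ℚ i ^ℚ j

  scaled-0 : ∀ x → scaled x 0 ≡ x 0
  scaled-0 x = trans (cong (λ t → x t *ℚ 1ℚ) (NP.*-zeroʳ m)) (QP.*-identityʳ (x 0))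

  scaled-1 : ∀ x → scaled x 1 ≡ x m *ℚ i
  scaled-1 x = cong₂ (λ t y → x t *ℚ y) (NP.*-identityʳ m) (QP.*-identityʳ i)

  scaled-recurrent : ∀ x → FibonacciLike x → Recurrent (scaled x)
  scaled-recurrent x x-rec j = begin
    x (m * (2 + j)) *ℚ i ^ℚ (2 + j)
      ≡⟨ cong (λ t → x t *ℚ i ^ℚ (2 + j)) (trans (NP.*-suc m (suc j)) (cong (_+_ m) (NP.*-suc m j))) ⟩
    x₂ *ℚ (i *ℚ (i *ℚ I))
      ≡⟨ solve 5 (λ x₂ s x₀ i I → x₂ :* (i :* (i :* I)) := (x₂ :+ s :* x₀ :- s :* x₀) :* (i :* (i :* I))) refl x₂ s x₀ i I ⟩
    (x₂ +ℚ s *ℚ x₀ - s *ℚ x₀) *ℚ (i *ℚ (i *ℚ I))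
      ≡⟨ cong (λ z → (z - s *ℚ x₀) *ℚ (i *ℚ (i *ℚ I))) (sym (luc-shift m x x-rec (m * j))) ⟩
    (L *ℚ x₁ - s *ℚ x₀) *ℚ (i *ℚ (i *ℚ I))
      ≡⟨ solve 6 (λ L x₁ s x₀ i I → (L :* x₁ :- s :* x₀) :* (i :* (i :* I)) := (L :* i) :* (x₁ :* (i :* I)) :+ :- (s :* (i :* i)) :* (x₀ :* I)) refl L x₁ s x₀ i I ⟩
    (L *ℚ i) *ℚ (x₁ *ℚ (i *ℚ I)) +ℚ - e *ℚ (x₀ *ℚ I)
      ≡⟨ cong (λ z → z *ℚ (x₁ *ℚ (i *ℚ I)) +ℚ - e *ℚ (x₀ *ℚ I)) luc*i≡1 ⟩
    1ℚ *ℚ (x₁ *ℚ (i *ℚ I)) +ℚ - e *ℚ (x₀ *ℚ I)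
      ≡⟨ cong (_+ℚ - e *ℚ (x₀ *ℚ I)) (QP.*-identityˡ (x₁ *ℚ (i *ℚ I))) ⟩
    x₁ *ℚ (i *ℚ I) +ℚ - e *ℚ (x₀ *ℚ I)
      ≡⟨ cong (λ t → x t *ℚ (i *ℚ I) +ℚ - e *ℚ (x₀ *ℚ I)) (sym (NP.*-suc m j)) ⟩
    scaled x (suc j) +ℚ - e *ℚ scaled x j ∎
    where
    L = ℕ→ℚ (luc m)
    s = sgn m
    x₁ = x (m + m * j)
    x₀ = x (m * j)
    x₂ = x (m + (m + m * j))
    I = i ^ℚ j

  sumTo-as-binomSum : ∀ (X : ℕ → ℕ) n →
    sumTo n (λ k → sgn (m * k) *ℚ (ℕ→ℚ ((n + k) C k) *ℚ (X (m * (n + 1 ∸ k)) /L[ m ]^ k)))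
      ≡ ℕ→ℚ (luc m ^ (n + 1)) *ℚ binomSum n (scaled (ℕ→ℚ ∘ X))
  sumTo-as-binomSum X n = trans (sumTo-cong n termwise) (sumTo-distribˡ n (term n (scaled (ℕ→ℚ ∘ X))) Lⁿ⁺¹)
    where
    Lⁿ⁺¹ = ℕ→ℚ (luc m ^ (n + 1))
    termwise : ∀ k → k ℕ.≤ n →
      sgn (m * k) *ℚ (ℕ→ℚ ((n + k) C k) *ℚ (X (m * (n + 1 ∸ k)) /L[ m ]^ k)) ≡ Lⁿ⁺¹ *ℚ term n (scaled (ℕ→ℚ ∘ X)) k
    termwise k k≤n = begin
      sgn (m * k) *ℚ (c *ℚ (X (m * (n + 1 ∸ k)) /L[ m ]^ k))
        ≡⟨ cong₂ (λ a b → a *ℚ (c *ℚ b)) (sgn-* m k) (/L^≡*i^ (X (m * (n + 1 ∸ k))) k) ⟩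
      sᵏ *ℚ (c *ℚ (x *ℚ iᵏ))
        ≡⟨ sym (QP.*-identityˡ (sᵏ *ℚ (c *ℚ (x *ℚ iᵏ)))) ⟩
      1ℚ *ℚ (sᵏ *ℚ (c *ℚ (x *ℚ iᵏ)))
        ≡⟨ cong (_*ℚ (sᵏ *ℚ (c *ℚ (x *ℚ iᵏ)))) (sym Lⁿ⁺¹*iᵏ*iⁿ⁺¹⁻ᵏ≡1) ⟩
      Lⁿ⁺¹ *ℚ (iᵏ *ℚ iⁿ⁺¹⁻ᵏ) *ℚ (sᵏ *ℚ (c *ℚ (x *ℚ iᵏ)))
        ≡⟨ solve 6 (λ Lⁿ⁺¹ sᵏ c x iᵏ iⁿ⁺¹⁻ᵏ → Lⁿ⁺¹ :* (iᵏ :* iⁿ⁺¹⁻ᵏ) :* (sᵏ :* (c :* (x :* iᵏ))) := Lⁿ⁺¹ :* (c :* ((sᵏ :* (iᵏ :* iᵏ)) :* (x :* iⁿ⁺¹⁻ᵏ)))) refl Lⁿ⁺¹ sᵏ c x iᵏ iⁿ⁺¹⁻ᵏ ⟩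
      Lⁿ⁺¹ *ℚ (c *ℚ ((sᵏ *ℚ (iᵏ *ℚ iᵏ)) *ℚ (x *ℚ iⁿ⁺¹⁻ᵏ)))
        ≡⟨ cong₂ (λ a t → Lⁿ⁺¹ *ℚ (c *ℚ (a *ℚ (ℕ→ℚ (X (m * (t ∸ k))) *ℚ i ^ℚ (t ∸ k))))) (sym (e^k≡sgn^k*i^k*i^k k)) (NP.+-comm n 1) ⟩
      Lⁿ⁺¹ *ℚ term n (scaled (ℕ→ℚ ∘ X)) k ∎
      where
      c = ℕ→ℚ ((n + k) C k)
      sᵏ = sgn m ^ℚ k
      x = ℕ→ℚ (X (m * (n + 1 ∸ k)))
      iᵏ = i ^ℚ k
      iⁿ⁺¹⁻ᵏ = i ^ℚ (n + 1 ∸ k)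
      Lⁿ⁺¹*iᵏ*iⁿ⁺¹⁻ᵏ≡1 : Lⁿ⁺¹ *ℚ (iᵏ *ℚ iⁿ⁺¹⁻ᵏ) ≡ 1ℚ
      Lⁿ⁺¹*iᵏ*iⁿ⁺¹⁻ᵏ≡1 = begin
        Lⁿ⁺¹ *ℚ (iᵏ *ℚ iⁿ⁺¹⁻ᵏ)          ≡⟨ cong (Lⁿ⁺¹ *ℚ_) (sym (^ℚ-distribˡ-+-* i k (n + 1 ∸ k))) ⟩
        Lⁿ⁺¹ *ℚ i ^ℚ (k + (n + 1 ∸ k)) ≡⟨ cong (λ t → Lⁿ⁺¹ *ℚ i ^ℚ t) (NP.m+[n∸m]≡n (NP.m≤n⇒m≤n+o 1 k≤n)) ⟩
        Lⁿ⁺¹ *ℚ i ^ℚ (n + 1)      ≡⟨ luc^k*i^k≡1 (n + 1) ⟩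
        1ℚ                     ∎

  centralSum-as-sumBelow : ∀ n →
    sumBelow n (λ k → (sgn (m * (k + 1)) *ℚ (1 /L[ m ]^ (2 * (k + 1)))) *ℚ ℕ→ℚ ((2 * k + 1) C k)) ≡ centralSum n
  centralSum-as-sumBelow n = sumBelow-cong n termwise
    where
    2k+1≡k+suc[k] : ∀ k → 2 * k + 1 ≡ k + suc k
    2k+1≡k+suc[k] k = trans (cong (λ z → k + z + 1) (NP.+-identityʳ k)) (trans (NP.+-assoc k k 1) (cong (_+_ k) (NP.+-comm k 1)))
    termwise : ∀ k → (sgn (m * (k + 1)) *ℚ (1 /L[ m ]^ (2 * (k + 1)))) *ℚ ℕ→ℚ ((2 * k + 1) C k) ≡ e ^ℚ suc k *ℚ ℕ→ℚ ((k + suc k) C k)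
    termwise k = begin
      (sgn (m * (k + 1)) *ℚ (1 /L[ m ]^ (2 * (k + 1)))) *ℚ ℕ→ℚ ((2 * k + 1) C k)
        ≡⟨ cong₂ (λ t b → (sgn (m * t) *ℚ (1 /L[ m ]^ (2 * t))) *ℚ ℕ→ℚ (b C k)) (NP.+-comm k 1) (2k+1≡k+suc[k] k) ⟩
      (sgn (m * suc k) *ℚ (1 /L[ m ]^ (2 * suc k))) *ℚ c
        ≡⟨ cong₂ (λ a b → (a *ℚ b) *ℚ c) (sgn-* m (suc k)) (/L^≡*i^ 1 (2 * suc k)) ⟩
      (sgn m ^ℚ suc k *ℚ (1ℚ *ℚ i ^ℚ (suc k + (suc k + 0)))) *ℚ c
        ≡⟨ cong (λ a → (sgn m ^ℚ suc k *ℚ a) *ℚ c) (trans (QP.*-identityˡ _)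
             (trans (cong (λ t → i ^ℚ (suc k + t)) (NP.+-identityʳ (suc k))) (^ℚ-distribˡ-+-* i (suc k) (suc k)))) ⟩
      (sgn m ^ℚ suc k *ℚ (i ^ℚ suc k *ℚ i ^ℚ suc k)) *ℚ c
        ≡⟨ cong (_*ℚ c) (sym (e^k≡sgn^k*i^k*i^k (suc k))) ⟩
      e ^ℚ suc k *ℚ c ∎
      where
      c = ℕ→ℚ ((k + suc k) C k)

  binomSum-scaled-closed : ∀ n x → FibonacciLike x →
    binomSum n (scaled x) ≡ x m *ℚ i +ℚ (x m *ℚ i +ℚ x m *ℚ i - x 0) *ℚ centralSum n
  binomSum-scaled-closed n x x-rec = begin
    binomSum n (scaled x)
      ≡⟨ binomSum-closed e⁻¹ e*e⁻¹≡1 n (scaled x) (scaled-recurrent x x-rec) ⟩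
    scaled x 1 +ℚ (scaled x 1 +ℚ scaled x 1 - scaled x 0) *ℚ centralSum n
      ≡⟨ cong₂ (λ a b → a +ℚ (a +ℚ a - b) *ℚ centralSum n) (scaled-1 x) (scaled-0 x) ⟩
    x m *ℚ i +ℚ (x m *ℚ i +ℚ x m *ℚ i - x 0) *ℚ centralSum n ∎

fibonacci-identity : ∀ n m →
  sumTo n (λ k → sgn (m * k) *ℚ (ℕ→ℚ ((n + k) C k) *ℚ (fib (m * (n + 1 ∸ k)) /L[ m ]^ k)))
    ≡ ℕ→ℚ (fib m * luc m ^ n) *ℚ (1ℚ +ℚ ℕ→ℚ 2 *ℚ sumBelow n (λ k → (sgn (m * (k + 1)) *ℚ (1 /L[ m ]^ (2 * (k + 1)))) *ℚ ℕ→ℚ ((2 * k + 1) C k)))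
fibonacci-identity n m = begin
  _ ≡⟨ sumTo-as-binomSum fib n ⟩
  ℕ→ℚ (luc m ^ (n + 1)) *ℚ binomSum n (scaled (ℕ→ℚ ∘ fib))
    ≡⟨ cong₂ _*ℚ_ (trans (cong (λ t → ℕ→ℚ (luc m ^ t)) (NP.+-comm n 1)) (ℕ→ℚ-* (luc m) (luc m ^ n)))
                  (binomSum-scaled-closed n (ℕ→ℚ ∘ fib) (λ j → ℕ→ℚ-+ (fib (suc j)) (fib j))) ⟩
  (L *ℚ Lⁿ) *ℚ (F *ℚ i +ℚ (F *ℚ i +ℚ F *ℚ i - 0ℚ) *ℚ centralSum n)
    ≡⟨ solve 5 (λ L Lⁿ F i S → (L :* Lⁿ) :* (F :* i :+ (F :* i :+ F :* i :- con 0ℚ) :* S)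
                              := (L :* i) :* ((F :* Lⁿ) :* (con 1ℚ :+ (con 1ℚ :+ con 1ℚ) :* S))) refl L Lⁿ F i (centralSum n) ⟩
  (L *ℚ i) *ℚ ((F *ℚ Lⁿ) *ℚ (1ℚ +ℚ ℕ→ℚ 2 *ℚ centralSum n))
    ≡⟨ cong₂ (λ a b → a *ℚ b) luc*i≡1 (cong₂ (λ a b → a *ℚ (1ℚ +ℚ ℕ→ℚ 2 *ℚ b)) (sym (ℕ→ℚ-* (fib m) (luc m ^ n))) (sym (centralSum-as-sumBelow n))) ⟩
  1ℚ *ℚ (ℕ→ℚ (fib m * luc m ^ n) *ℚ (1ℚ +ℚ ℕ→ℚ 2 *ℚ S)) ≡⟨ QP.*-identityˡ _ ⟩
  ℕ→ℚ (fib m * luc m ^ n) *ℚ (1ℚ +ℚ ℕ→ℚ 2 *ℚ S) ∎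
  where
  open Scaling m
  open BinomialConvolution e
  L = ℕ→ℚ (luc m)
  Lⁿ = ℕ→ℚ (luc m ^ n)
  F = ℕ→ℚ (fib m)
  S = sumBelow n (λ k → (sgn (m * (k + 1)) *ℚ (1 /L[ m ]^ (2 * (k + 1)))) *ℚ ℕ→ℚ ((2 * k + 1) C k))

lucas-identity : ∀ n m →
  sumTo n (λ k → sgn (m * k) *ℚ (ℕ→ℚ ((n + k) C k) *ℚ (luc (m * (n + 1 ∸ k)) /L[ m ]^ k))) ≡ ℕ→ℚ (luc m ^ (n + 1))
lucas-identity n m = begin
  _ ≡⟨ sumTo-as-binomSum luc n ⟩
  P *ℚ binomSum n (scaled (ℕ→ℚ ∘ luc))
    ≡⟨ cong (P *ℚ_) (binomSum-scaled-closed n (ℕ→ℚ ∘ luc) (λ j → ℕ→ℚ-+ (luc (suc j)) (luc j))) ⟩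
  P *ℚ (ℕ→ℚ (luc m) *ℚ i +ℚ (ℕ→ℚ (luc m) *ℚ i +ℚ ℕ→ℚ (luc m) *ℚ i - ℕ→ℚ 2) *ℚ centralSum n)
    ≡⟨ cong (λ a → P *ℚ (a +ℚ (a +ℚ a - ℕ→ℚ 2) *ℚ centralSum n)) luc*i≡1 ⟩
  P *ℚ (1ℚ +ℚ (1ℚ +ℚ 1ℚ - (1ℚ +ℚ 1ℚ)) *ℚ centralSum n)
    ≡⟨ solve 2 (λ P S → P :* (con 1ℚ :+ (con 1ℚ :+ con 1ℚ :- (con 1ℚ :+ con 1ℚ)) :* S) := P) refl P (centralSum n) ⟩
  P ∎
  where
  open Scaling m
  open BinomialConvolution e
  P = ℕ→ℚ (luc m ^ (n + 1))

theorem14 : (n m : ℕ) →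
    (sumTo n (λ k → sgn (m * k) *ℚ (ℕ→ℚ ((n + k) C k) *ℚ (fib (m * (n + 1 ∸ k)) /L[ m ]^ k)))
      ≡ ℕ→ℚ (fib m * luc m ^ n) *ℚ (1ℚ +ℚ ℕ→ℚ 2 *ℚ sumBelow n (λ k → (sgn (m * (k + 1)) *ℚ (1 /L[ m ]^ (2 * (k + 1)))) *ℚ ℕ→ℚ ((2 * k + 1) C k))))
    × (sumTo n (λ k → sgn (m * k) *ℚ (ℕ→ℚ ((n + k) C k) *ℚ (luc (m * (n + 1 ∸ k)) /L[ m ]^ k)))
      ≡ ℕ→ℚ (luc m ^ (n + 1)))
theorem14 n m = fibonacci-identity n m , lucas-identity n m
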